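{- For all integers $n > 2$, $$\frac{f(n)}{\binom{n}{2}} \le \frac{1}{\binom{n}{2}} + \max_{2 \le k < n} \frac{f(k)}{\binom{k}{2}}.$$
   Context: A family $\mathcal{F}$ of subsets of a set is $2$-laminar if whenever $A,B \in \mathcal{F}$ satisfy $|A \cap B| \ge 2$, we have $A \subseteq B$ or $B \subseteq A$. For a positive integer $n$, $f(n)$ denotes the maximum of $|\{A \in \mathcal{F} : |A| \ge 2\}|$ over all $2$-laminar families $\mathcal{F}$ of subsets of $[n]=\{1,\dots,n\}$. -}

module Defs where

open import Data.Nat using (ℕ; zero; suc; _≤_; _≤?_)
open import Data.Nat.Combinatorics using (_C_)
open import Data.Integer using (+_)
open import Data.Rational using (ℚ; _/_; 0ℚ; _⊔_)
open import Data.Fin.Subset using (Subset; _∩_; _⊆_; ∣_∣)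
open import Data.List using (List; length; filter)
open import Data.List.Membership.Propositional using (_∈_)
open import Data.List.Relation.Unary.Unique.Propositional using (Unique)
open import Data.Product using (Σ; _×_)
open import Data.Sum using (_⊎_)
open import Relation.Binary.PropositionalEquality using (_≡_)

-- A family of subsets of [n] = Fin n, represented as a duplicate-free list.
-- 2-laminar: any two members meeting in >= 2 elements are nested.
TwoLaminar : ∀ {n} → List (Subset n) → Set
TwoLaminar {n} F = ∀ (A B : Subset n) → A ∈ F → B ∈ F →
  2 ≤ ∣ A ∩ B ∣ → (A ⊆ B) ⊎ (B ⊆ A)

bigCount : ∀ {n} → List (Subset n) → ℕ
bigCount F = length (filter (λ A → 2 ≤? ∣ A ∣) F)

IsF : ℕ → ℕ → Set
IsF n m =
  Σ (List (Subset n)) (λ F → Unique F × TwoLaminar F × bigCount F ≡ m)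
  × (∀ (F : List (Subset n)) → Unique F → TwoLaminar F → bigCount F ≤ m)

-- a / d as a rational (d = 0 never occurs in uses: denominators are C(k,2), k ≥ 2)
frac : ℕ → ℕ → ℚ
frac a zero = 0ℚ
frac a (suc d) = + a / suc d

ratio : (ℕ → ℕ) → ℕ → ℚ
ratio f k = frac (f k) (k C 2)

-- max_{2 ≤ k < n} f(k)/C(k,2)   (only meaningful for n ≥ 3)
maxRatio : (ℕ → ℕ) → ℕ → ℚ
maxRatio f 0 = 0ℚ
maxRatio f 1 = 0ℚ
maxRatio f 2 = 0ℚ
maxRatio f 3 = ratio f 2
maxRatio f (suc (suc (suc (suc m)))) =
  maxRatio f (suc (suc (suc m))) ⊔ ratio f (suc (suc (suc m)))

-- Let F be 2-laminar on [n] and M the largest ratio f(k)/C(k,2) with 2 ≤ k < n. Besides [n]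
-- itself, take a largest big member A: a big member B not inside A meets A in at most one point,
-- since meeting it in two would force A ⊆ B, and then B = A by maximality. The
-- members inside A form a 2-laminar family on A, so there are at most f(|A|) ≤ M·C(|A|,2) big
-- ones. Repeating on the rest produces blocks A₁, …, A_r that pairwise share at most one point,
-- so their 2-subsets are disjoint and Σ C(|Aᵢ|,2) ≤ C(n,2). Hence f(n) ≤ 1 + M·C(n,2).
module Submission where

open import Algebra.Properties.CommutativeSemigroup using (interchange)
open import Data.Empty using (⊥-elim)
open import Data.Fin.Subset using (Subset; inside; outside; _∩_; _⊆_; ∣_∣; ⊤) renaming (⊥ to ∅)
open import Data.Fin.Subset.Properties
  using ( drop-∷-⊆; out⊆; in⊆in; ⊆-refl; ⊆-reflexive; ⊆-trans; ⊆-antisym; _⊆?_; p∩q⊆p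
        ; p⊆q⇒∣p∣≤∣q∣; ∣p∣≤n; ∣p∣≡n⇒p≡⊤; ∣⊥∣≡0; ∩-zeroˡ; ∩-zeroʳ )
open import Data.Integer using (-[1+_])
import Data.Integer as ℤ
import Data.Integer.Properties as ℤ
open import Data.List using (List; []; _∷_; map; filter; length)
open import Data.List.Extrema.Nat using (argmax; argmax-all; f[⊥]≤f[argmax]; f[xs]≤f[argmax])
open import Data.List.Membership.Propositional using (_∈_)
open import Data.List.Membership.Propositional.Properties using (∈-filter⁻; ∈-filter⁺; ∈-map⁻)
open import Data.List.Properties
  using (map-∘; map-cong; length-filter; filter-notAll; filter-accept; filter-reject)
open import Data.List.Relation.Unary.All using (All; []; _∷_)
import Data.List.Relation.Unary.All as All
import Data.List.Relation.Unary.All.Properties as All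
open import Data.List.Relation.Unary.AllPairs using (AllPairs; []; _∷_)
import Data.List.Relation.Unary.AllPairs as AllPairs
import Data.List.Relation.Unary.AllPairs.Properties as AllPairs
open import Data.List.Relation.Unary.Any using () renaming (here to hereₗ; there to thereₗ)
import Data.List.Relation.Unary.Any as Any
open import Data.List.Relation.Unary.Unique.Propositional using (Unique)
import Data.List.Relation.Unary.Unique.Propositional.Properties as Unique
open import Data.Nat using (ℕ; zero; suc; _+_; _*_; _≤_; _<_; _≤?_; _<?_; z≤n; s≤s; s≤s⁻¹)
open import Data.Nat.Combinatorics using (_C_; nC1≡n; nCk+nC[k+1]≡[n+1]C[k+1])
open import Data.Nat.Coprimality using (Coprime)
open import Data.Nat.Induction using (<-wellFounded)
open import Data.Nat.ListAction using (sum)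
open import Data.Nat.Properties
open import Data.Product using (∃; _×_; _,_; proj₁; proj₂)
open import Data.Rational using (ℚ; mkℚ; 0ℚ; toℚᵘ; nonNegative)
import Data.Rational as ℚ
import Data.Rational.Properties as ℚ
import Data.Rational.Unnormalised as ℚᵘ
import Data.Rational.Unnormalised.Properties as ℚᵘ
open import Data.Sum using (_⊎_; inj₁; inj₂; [_,_]′)
open import Data.Vec using ([]; _∷_; head; tail; here)
open import Function using (_∘_)
open import Induction.WellFounded using (Acc; acc)
open import Level using (Level)
open import Relation.Binary.PropositionalEquality
open import Relation.Nullary using (Dec; yes; no; ¬_; contradiction)
open import Relation.Unary using (Pred; Decidable)
open import Relation.Unary.Properties using (∁?)

open import Defs

private
  variable
    X : Set
    ℓ ℓ′ : Level
    m n : ℕ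

-- B ∩ S, as a subset of S ≅ Fin ∣ S ∣.
restrict : (S : Subset n) → Subset n → Subset ∣ S ∣
restrict []            []      = []
restrict (outside ∷ S) (_ ∷ B) = restrict S B
restrict (inside  ∷ S) (x ∷ B) = x ∷ restrict S B

∣restrict∣ : (S B : Subset n) → B ⊆ S → ∣ restrict S B ∣ ≡ ∣ B ∣
∣restrict∣ []            []            B⊆S = refl
∣restrict∣ (outside ∷ S) (outside ∷ B) B⊆S = ∣restrict∣ S B (drop-∷-⊆ B⊆S)
∣restrict∣ (outside ∷ S) (inside  ∷ B) B⊆S = contradiction (B⊆S here) λ ()
∣restrict∣ (inside  ∷ S) (outside ∷ B) B⊆S = ∣restrict∣ S B (drop-∷-⊆ B⊆S)
∣restrict∣ (inside  ∷ S) (inside  ∷ B) B⊆S = cong suc (∣restrict∣ S B (drop-∷-⊆ B⊆S))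

restrict-∩ : (S B C : Subset n) → restrict S (B ∩ C) ≡ restrict S B ∩ restrict S C
restrict-∩ []            []      []      = refl
restrict-∩ (outside ∷ S) (_ ∷ B) (_ ∷ C) = restrict-∩ S B C
restrict-∩ (inside  ∷ S) (_ ∷ B) (_ ∷ C) = cong (_ ∷_) (restrict-∩ S B C)

restrict-mono : (S : Subset n) {B C : Subset n} → B ⊆ C → restrict S B ⊆ restrict S C
restrict-mono []            {[]}          {[]}          B⊆C = B⊆C
restrict-mono (outside ∷ S) {_ ∷ B}       {_ ∷ C}       B⊆C = restrict-mono S (drop-∷-⊆ B⊆C)
restrict-mono (inside  ∷ S) {outside ∷ B} {_ ∷ C}       B⊆C = out⊆ (restrict-mono S (drop-∷-⊆ B⊆C))
restrict-mono (inside  ∷ S) {inside ∷ B}  {outside ∷ C} B⊆C = contradiction (B⊆C here) λ ()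
restrict-mono (inside  ∷ S) {inside ∷ B}  {inside ∷ C}  B⊆C = in⊆in (restrict-mono S (drop-∷-⊆ B⊆C))

restrict-reflects-⊆ : (S : Subset n) {B C : Subset n} → B ⊆ S → restrict S B ⊆ restrict S C → B ⊆ C
restrict-reflects-⊆ []            {[]}          {[]}          _   h = h
restrict-reflects-⊆ (outside ∷ S) {outside ∷ B} {_ ∷ C}       B⊆S h =
  out⊆ (restrict-reflects-⊆ S (drop-∷-⊆ B⊆S) h)
restrict-reflects-⊆ (outside ∷ S) {inside ∷ B}  {_ ∷ C}       B⊆S h = contradiction (B⊆S here) λ ()
restrict-reflects-⊆ (inside  ∷ S) {outside ∷ B} {_ ∷ C}       B⊆S h =
  out⊆ (restrict-reflects-⊆ S (drop-∷-⊆ B⊆S) (drop-∷-⊆ h))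
restrict-reflects-⊆ (inside  ∷ S) {inside ∷ B}  {outside ∷ C} B⊆S h = contradiction (h here) λ ()
restrict-reflects-⊆ (inside  ∷ S) {inside ∷ B}  {inside ∷ C}  B⊆S h =
  in⊆in (restrict-reflects-⊆ S (drop-∷-⊆ B⊆S) (drop-∷-⊆ h))

restrict-injective : (S : Subset n) {B C : Subset n} → B ⊆ S → C ⊆ S → restrict S B ≡ restrict S C → B ≡ C
restrict-injective S B⊆S C⊆S eq =
  ⊆-antisym (restrict-reflects-⊆ S B⊆S (⊆-reflexive eq)) (restrict-reflects-⊆ S C⊆S (⊆-reflexive (sym eq)))

p⊆q∧∣q∣≤∣p∣⇒p≡q : {p q : Subset n} → p ⊆ q → ∣ q ∣ ≤ ∣ p ∣ → p ≡ q
p⊆q∧∣q∣≤∣p∣⇒p≡q {p = []}          {[]}          _   _ = refl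
p⊆q∧∣q∣≤∣p∣⇒p≡q {p = outside ∷ p} {outside ∷ q} p⊆q ∣q∣≤∣p∣ =
  cong (outside ∷_) (p⊆q∧∣q∣≤∣p∣⇒p≡q (drop-∷-⊆ p⊆q) ∣q∣≤∣p∣)
p⊆q∧∣q∣≤∣p∣⇒p≡q {p = outside ∷ p} {inside ∷ q}  p⊆q ∣q∣≤∣p∣ =
  contradiction ∣q∣≤∣p∣ (<⇒≱ (s≤s (p⊆q⇒∣p∣≤∣q∣ (drop-∷-⊆ p⊆q))))
p⊆q∧∣q∣≤∣p∣⇒p≡q {p = inside ∷ p}  {outside ∷ q} p⊆q _ = contradiction (p⊆q here) λ ()
p⊆q∧∣q∣≤∣p∣⇒p≡q {p = inside ∷ p}  {inside ∷ q}  p⊆q ∣q∣≤∣p∣ =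
  cong (inside ∷_) (p⊆q∧∣q∣≤∣p∣⇒p≡q (drop-∷-⊆ p⊆q) (s≤s⁻¹ ∣q∣≤∣p∣))

sum-map-+ : (g h : X → ℕ) (xs : List X) →
  sum (map (λ x → g x + h x) xs) ≡ sum (map g xs) + sum (map h xs)
sum-map-+ g h []       = refl
sum-map-+ g h (x ∷ xs) = begin
  g x + h x + sum (map (λ x → g x + h x) xs)  ≡⟨ cong (g x + h x +_) (sum-map-+ g h xs) ⟩
  g x + h x + (sum (map g xs) + sum (map h xs)) ≡⟨ interchange +-commutativeSemigroup (g x) (h x) _ _ ⟩
  g x + sum (map g xs) + (h x + sum (map h xs)) ∎
  where open ≡-Reasoning

sum-map-mono : {g h : X → ℕ} (xs : List X) → All (λ x → g x ≤ h x) xs → sum (map g xs) ≤ sum (map h xs)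
sum-map-mono []       []           = z≤n
sum-map-mono (x ∷ xs) (gx≤hx ∷ ≤s) = +-mono-≤ gx≤hx (sum-map-mono xs ≤s)

sum-map-*ˡ : (c : ℕ) (g : X → ℕ) (xs : List X) → sum (map (λ x → c * g x) xs) ≡ c * sum (map g xs)
sum-map-*ˡ c g []       = sym (*-zeroʳ c)
sum-map-*ˡ c g (x ∷ xs) = trans (cong (c * g x +_) (sum-map-*ˡ c g xs)) (sym (*-distribˡ-+ c (g x) _))

length≤1-if-allEqual : {x : X} (xs : List X) → Unique xs → All (_≡ x) xs → length xs ≤ 1
length≤1-if-allEqual []          _                 _                 = z≤n
length≤1-if-allEqual (_ ∷ [])    _                 _                 = s≤s z≤n
length≤1-if-allEqual (_ ∷ _ ∷ _) ((y≢z ∷ _) ∷ _) (y≡x ∷ z≡x ∷ _) = contradiction (trans y≡x (sym z≡x)) y≢z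

length-filter-partition : {P : Pred X ℓ} {Q : Pred X ℓ′} (P? : Decidable P) (Q? : Decidable Q) (xs : List X) →
  length (filter Q? xs) ≡ length (filter Q? (filter P? xs)) + length (filter Q? (filter (∁? P?) xs))
length-filter-partition P? Q? []       = refl
length-filter-partition P? Q? (x ∷ xs) with P? x
... | yes _ with Q? x
...   | yes _ = cong suc (length-filter-partition P? Q? xs)
...   | no  _ = length-filter-partition P? Q? xs
length-filter-partition P? Q? (x ∷ xs) | no _ with Q? x
...   | yes _ = trans (cong suc (length-filter-partition P? Q? xs)) (sym (+-suc _ _))
...   | no  _ = length-filter-partition P? Q? xs

Disjoint : Subset n → Subset n → Set
Disjoint A B = ∣ A ∩ B ∣ ≡ 0

AlmostDisjoint : Subset n → Subset n → Set
AlmostDisjoint A B = ∣ A ∩ B ∣ ≤ 1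

∣head∣ : Subset (suc n) → ℕ
∣head∣ A = ∣ head A ∷ [] ∣

∣∣≡∣head∣+∣tail∣ : (A : Subset (suc n)) → ∣ A ∣ ≡ ∣head∣ A + ∣ tail A ∣
∣∣≡∣head∣+∣tail∣ (inside  ∷ _) = refl
∣∣≡∣head∣+∣tail∣ (outside ∷ _) = refl

∣tail∣≤∣∣ : (A : Subset (suc n)) → ∣ tail A ∣ ≤ ∣ A ∣
∣tail∣≤∣∣ A = ≤-trans (m≤n+m ∣ tail A ∣ (∣head∣ A)) (≤-reflexive (sym (∣∣≡∣head∣+∣tail∣ A)))

∣tail-∩∣≤∣∩∣ : (A B : Subset (suc n)) → ∣ tail A ∩ tail B ∣ ≤ ∣ A ∩ B ∣
∣tail-∩∣≤∣∩∣ (x ∷ A) (y ∷ B) = ∣tail∣≤∣∣ ((x ∷ A) ∩ (y ∷ B))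

sum-∣head∣-disjoint : (Ds : List (Subset (suc n))) → AllPairs Disjoint Ds → sum (map ∣head∣ Ds) ≤ 1
sum-∣head∣-disjoint []                    []          = z≤n
sum-∣head∣-disjoint ((outside ∷ _) ∷ Ds) (_ ∷ ds)    = sum-∣head∣-disjoint Ds ds
sum-∣head∣-disjoint ((inside ∷ D) ∷ Ds)  (D#Ds ∷ _) = s≤s (≤-reflexive (headless Ds D#Ds))
  where
  headless : (Es : List (Subset (suc _))) → All (Disjoint (inside ∷ D)) Es → sum (map ∣head∣ Es) ≡ 0
  headless []                   []         = refl
  headless ((outside ∷ _) ∷ Es) (_ ∷ es)   = headless Es es
  headless ((inside ∷ _) ∷ Es)  (() ∷ _)

sum-∣∣-disjoint : ∀ n (Ds : List (Subset n)) → AllPairs Disjoint Ds → sum (map ∣_∣ Ds) ≤ n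
sum-∣∣-disjoint zero    []        []       = z≤n
sum-∣∣-disjoint zero    ([] ∷ Ds) (_ ∷ ds) = sum-∣∣-disjoint zero Ds ds
sum-∣∣-disjoint (suc n) Ds        ds       = begin
  sum (map ∣_∣ Ds)                                   ≡⟨ cong sum (map-cong ∣∣≡∣head∣+∣tail∣ Ds) ⟩
  sum (map (λ D → ∣head∣ D + ∣ tail D ∣) Ds)         ≡⟨ sum-map-+ ∣head∣ (∣_∣ ∘ tail) Ds ⟩
  sum (map ∣head∣ Ds) + sum (map (∣_∣ ∘ tail) Ds)    ≡⟨ cong (sum (map ∣head∣ Ds) +_) (cong sum (map-∘ Ds)) ⟩
  sum (map ∣head∣ Ds) + sum (map ∣_∣ (map tail Ds))  ≤⟨ +-mono-≤ (sum-∣head∣-disjoint Ds ds)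
                                                          (sum-∣∣-disjoint n (map tail Ds) tails-disjoint) ⟩
  1 + n                                              ∎
  where
  open ≤-Reasoning
  tails-disjoint : AllPairs Disjoint (map tail Ds)
  tails-disjoint = AllPairs.map⁺
    (AllPairs.map (λ {A B} A#B → n≤0⇒n≡0 (≤-trans (∣tail-∩∣≤∣∩∣ A B) (≤-reflexive A#B))) ds)

-- The pairs {0, i} inside A are indexed by i ∈ link A.
link : Subset (suc n) → Subset n
link (inside  ∷ A) = A
link (outside ∷ _) = ∅

C2-suc : ∀ m → suc m C 2 ≡ m C 2 + m
C2-suc m = begin
  suc m C 2       ≡⟨ nCk+nC[k+1]≡[n+1]C[k+1] m 1 ⟨
  m C 1 + m C 2   ≡⟨ +-comm (m C 1) (m C 2) ⟩
  m C 2 + m C 1   ≡⟨ cong (m C 2 +_) (nC1≡n m) ⟩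
  m C 2 + m       ∎
  where open ≡-Reasoning

∣∣C2≡∣tail∣C2+∣link∣ : (A : Subset (suc n)) → ∣ A ∣ C 2 ≡ ∣ tail A ∣ C 2 + ∣ link A ∣
∣∣C2≡∣tail∣C2+∣link∣     (inside  ∷ A) = C2-suc ∣ A ∣
∣∣C2≡∣tail∣C2+∣link∣ {n} (outside ∷ A) = sym (trans (cong (∣ A ∣ C 2 +_) (∣⊥∣≡0 n)) (+-identityʳ _))

link-disjoint : (A B : Subset (suc n)) → AlmostDisjoint A B → Disjoint (link A) (link B)
link-disjoint     (inside  ∷ A) (inside  ∷ B) A≬B = n≤0⇒n≡0 (s≤s⁻¹ A≬B)
link-disjoint {n} (inside  ∷ A) (outside ∷ B) _   = trans (cong ∣_∣ (∩-zeroʳ A)) (∣⊥∣≡0 n)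
link-disjoint {n} (outside ∷ A) B             _   = trans (cong ∣_∣ (∩-zeroˡ (link B))) (∣⊥∣≡0 n)

sum-C2-almostDisjoint : ∀ n (As : List (Subset n)) → AllPairs AlmostDisjoint As →
  sum (map ((_C 2) ∘ ∣_∣) As) ≤ n C 2
sum-C2-almostDisjoint zero    []        []       = z≤n
sum-C2-almostDisjoint zero    ([] ∷ As) (_ ∷ as) = sum-C2-almostDisjoint zero As as
sum-C2-almostDisjoint (suc n) As        as       = begin
  sum (map ((_C 2) ∘ ∣_∣) As)
    ≡⟨ cong sum (map-cong ∣∣C2≡∣tail∣C2+∣link∣ As) ⟩
  sum (map (λ A → ∣ tail A ∣ C 2 + ∣ link A ∣) As)
    ≡⟨ sum-map-+ ((_C 2) ∘ ∣_∣ ∘ tail) (∣_∣ ∘ link) As ⟩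
  sum (map ((_C 2) ∘ ∣_∣ ∘ tail) As) + sum (map (∣_∣ ∘ link) As)
    ≡⟨ cong₂ _+_ (cong sum (map-∘ As)) (cong sum (map-∘ As)) ⟩
  sum (map ((_C 2) ∘ ∣_∣) (map tail As)) + sum (map ∣_∣ (map link As))
    ≤⟨ +-mono-≤ (sum-C2-almostDisjoint n (map tail As) tails-almostDisjoint)
                (sum-∣∣-disjoint n (map link As) links-disjoint) ⟩
  n C 2 + n
    ≡⟨ C2-suc n ⟨
  suc n C 2 ∎
  where
  open ≤-Reasoning
  tails-almostDisjoint : AllPairs AlmostDisjoint (map tail As)
  tails-almostDisjoint = AllPairs.map⁺ (AllPairs.map (λ {A B} → ≤-trans (∣tail-∩∣≤∣∩∣ A B)) as)
  links-disjoint : AllPairs Disjoint (map link As)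
  links-disjoint = AllPairs.map⁺ (AllPairs.map (λ {A B} → link-disjoint A B) as)

big? : (A : Subset n) → Dec (2 ≤ ∣ A ∣)
big? A = 2 ≤? ∣ A ∣

bigCount-∷-big : (A : Subset n) (F : List (Subset n)) → 2 ≤ ∣ A ∣ → bigCount (A ∷ F) ≡ suc (bigCount F)
bigCount-∷-big A F big = cong length (filter-accept big? {A} {F} big)

bigCount-∷-small : (A : Subset n) (F : List (Subset n)) → ¬ 2 ≤ ∣ A ∣ → bigCount (A ∷ F) ≡ bigCount F
bigCount-∷-small A F small = cong length (filter-reject big? {A} {F} small)

bigCount-partition : {P : Pred (Subset n) ℓ} (P? : Decidable P) (F : List (Subset n)) →
  bigCount F ≡ bigCount (filter P? F) + bigCount (filter (∁? P?) F)
bigCount-partition P? = length-filter-partition P? big?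

bigCount-map : (h : Subset n → Subset m) (F : List (Subset n)) → All (λ A → ∣ h A ∣ ≡ ∣ A ∣) F →
  bigCount (map h F) ≡ bigCount F
bigCount-map h []      []            = refl
bigCount-map h (A ∷ F) (∣hA∣≡∣A∣ ∷ ≡s) with big? A
... | yes big   = trans (bigCount-∷-big (h A) (map h F) (subst (2 ≤_) (sym ∣hA∣≡∣A∣) big))
  (trans (cong suc (bigCount-map h F ≡s)) (sym (bigCount-∷-big A F big)))
... | no  small = trans (bigCount-∷-small (h A) (map h F) (small ∘ subst (2 ≤_) ∣hA∣≡∣A∣))
  (trans (bigCount-map h F ≡s) (sym (bigCount-∷-small A F small)))

TwoLaminar-filter : {P : Pred (Subset n) ℓ} (P? : Decidable P) {F : List (Subset n)} →
  TwoLaminar F → TwoLaminar (filter P? F)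
TwoLaminar-filter P? lam A B A∈ B∈ = lam A B (proj₁ (∈-filter⁻ P? A∈)) (proj₁ (∈-filter⁻ P? B∈))

Unique-restrict : (S : Subset n) (F : List (Subset n)) → All (_⊆ S) F → Unique F → Unique (map (restrict S) F)
Unique-restrict S []      []           []          = []
Unique-restrict S (A ∷ F) (A⊆S ∷ F⊆S) (A∉F ∷ u) =
  All.map⁺ (All.zipWith {P = _⊆ S} (λ (B⊆S , A≢B) → A≢B ∘ restrict-injective S A⊆S B⊆S) (F⊆S , A∉F))
  ∷ Unique-restrict S F F⊆S u

TwoLaminar-restrict : (S : Subset n) (F : List (Subset n)) → All (_⊆ S) F → TwoLaminar F →
  TwoLaminar (map (restrict S) F)
TwoLaminar-restrict S F F⊆S lam _ _ A′∈ B′∈ 2≤∣A′∩B′∣ with ∈-map⁻ (restrict S) A′∈ | ∈-map⁻ (restrict S) B′∈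
... | A , A∈F , refl | B , B∈F , refl =
  [ inj₁ ∘ restrict-mono S , inj₂ ∘ restrict-mono S ]′ (lam A B A∈F B∈F 2≤∣A∩B∣)
  where
  2≤∣A∩B∣ : 2 ≤ ∣ A ∩ B ∣
  2≤∣A∩B∣ = subst (2 ≤_) (begin
    ∣ restrict S A ∩ restrict S B ∣  ≡⟨ cong ∣_∣ (restrict-∩ S A B) ⟨
    ∣ restrict S (A ∩ B) ∣           ≡⟨ ∣restrict∣ S (A ∩ B) (⊆-trans (p∩q⊆p A B) (All.lookup F⊆S A∈F)) ⟩
    ∣ A ∩ B ∣                        ∎) 2≤∣A′∩B′∣
    where open ≡-Reasoning

BigCountBound : (ℕ → ℕ) → Set
BigCountBound g = ∀ {k} (F : List (Subset k)) → Unique F → TwoLaminar F → bigCount F ≤ g k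

bigCount≤-within : {g : ℕ → ℕ} → BigCountBound g → (S : Subset n) (F : List (Subset n)) →
  Unique F → TwoLaminar F → All (_⊆ S) F → bigCount F ≤ g ∣ S ∣
bigCount≤-within bound S F u lam F⊆S =
  subst (_≤ _) (bigCount-map (restrict S) F (All.map (∣restrict∣ S _) F⊆S))
    (bound (map (restrict S) F) (Unique-restrict S F F⊆S u) (TwoLaminar-restrict S F F⊆S lam))

IsLargestBig : List (Subset n) → Subset n → Set
IsLargestBig F A = A ∈ F × 2 ≤ ∣ A ∣ × (∀ {B} → B ∈ F → 2 ≤ ∣ B ∣ → ∣ B ∣ ≤ ∣ A ∣)

largestBig : (F : List (Subset n)) → bigCount F ≡ 0 ⊎ ∃ (IsLargestBig F)
largestBig F with filter big? F in eq
... | []     = inj₁ refl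
... | B ∷ Bs = inj₂ (A , proj₁ A∈F∧big , proj₂ A∈F∧big , largest)
  where
  A = argmax ∣_∣ B Bs
  A∈F∧big : A ∈ F × 2 ≤ ∣ A ∣
  A∈F∧big = ∈-filter⁻ big? (subst (A ∈_) (sym eq) (argmax-all ∣_∣ (hereₗ refl) (All.tabulate thereₗ)))
  largest : ∀ {C} → C ∈ F → 2 ≤ ∣ C ∣ → ∣ C ∣ ≤ ∣ A ∣
  largest C∈F big = All.lookup (f[⊥]≤f[argmax] {f = ∣_∣} B Bs ∷ f[xs]≤f[argmax] {f = ∣_∣} B Bs)
                               (subst (_ ∈_) eq (∈-filter⁺ big? C∈F big))

largestBig-meets-nonSubsets : {F : List (Subset n)} {A B : Subset n} → TwoLaminar F → IsLargestBig F A →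
  B ∈ F → 2 ≤ ∣ B ∣ → ¬ B ⊆ A → AlmostDisjoint A B
largestBig-meets-nonSubsets {A = A} {B} lam (A∈F , _ , largest) B∈F big B⊈A with 2 ≤? ∣ A ∩ B ∣
... | no  ∣A∩B∣<2 = ≤-pred (≰⇒> ∣A∩B∣<2)
... | yes 2≤∣A∩B∣ with lam A B A∈F B∈F 2≤∣A∩B∣
...   | inj₂ B⊆A = ⊥-elim (B⊈A B⊆A)
...   | inj₁ A⊆B = ⊥-elim (B⊈A (⊆-reflexive (sym (p⊆q∧∣q∣≤∣p∣⇒p≡q A⊆B (largest B∈F big)))))

record Blocks (g : ℕ → ℕ) (F : List (Subset n)) : Set where
  field
    blocks         : List (Subset n)
    blocks⊆F       : All (_∈ F) blocks
    blocks-big     : All (λ A → 2 ≤ ∣ A ∣) blocks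
    almostDisjoint : AllPairs AlmostDisjoint blocks
    bigCount≤      : bigCount F ≤ sum (map (g ∘ ∣_∣) blocks)

blocksOf : {g : ℕ → ℕ} → BigCountBound g → (F : List (Subset n)) → Acc _<_ (length F) →
  Unique F → TwoLaminar F → Blocks g F
blocksOf bound F (acc rs) u lam with largestBig F
... | inj₁ none = record
  { blocks = [] ; blocks⊆F = [] ; blocks-big = [] ; almostDisjoint = [] ; bigCount≤ = ≤-reflexive none }
... | inj₂ (A , largest@(A∈F , A-big , _)) = record
  { blocks         = A ∷ R.blocks
  ; blocks⊆F       = A∈F ∷ All.map (proj₁ ∘ ∈-filter⁻ outside?) R.blocks⊆F
  ; blocks-big     = A-big ∷ R.blocks-big
  ; almostDisjoint = All.zipWith meets (R.blocks⊆F , R.blocks-big) ∷ R.almostDisjoint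
  ; bigCount≤      = ≤-trans (≤-reflexive (bigCount-partition (_⊆? A) F))
      (+-mono-≤ (bigCount≤-within bound A (filter (_⊆? A) F) (Unique.filter⁺ (_⊆? A) {F} u)
                   (TwoLaminar-filter (_⊆? A) lam) (All.tabulate (proj₂ ∘ ∈-filter⁻ (_⊆? A) {xs = F})))
                R.bigCount≤)
  }
  where
  outside? = ∁? (_⊆? A)
  shorter : length (filter outside? F) < length F
  shorter = filter-notAll outside? F (Any.map (λ { refl A⊈A → A⊈A ⊆-refl }) A∈F)
  module R = Blocks (blocksOf bound (filter outside? F) (rs shorter) (Unique.filter⁺ outside? {F} u)
                                (TwoLaminar-filter outside? lam))
  meets : ∀ {B} → B ∈ filter outside? F × 2 ≤ ∣ B ∣ → AlmostDisjoint A B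
  meets (B∈ , B-big) = let (B∈F , B⊈A) = ∈-filter⁻ outside? B∈ in
    largestBig-meets-nonSubsets lam largest B∈F B-big B⊈A

proper? : (A : Subset n) → Dec (∣ A ∣ < n)
proper? A = ∣ A ∣ <? _

bigCount≤1+bigCount-proper : (F : List (Subset n)) → Unique F → bigCount F ≤ 1 + bigCount (filter proper? F)
bigCount≤1+bigCount-proper {n} F u = begin
  bigCount F                                                      ≡⟨ bigCount-partition proper? F ⟩
  bigCount (filter proper? F) + bigCount (filter (∁? proper?) F)  ≤⟨ +-monoʳ-≤ _ atMostOne ⟩
  bigCount (filter proper? F) + 1                                 ≡⟨ +-comm _ 1 ⟩
  1 + bigCount (filter proper? F)                                 ∎
  where
  open ≤-Reasoning
  full : ∀ {B} → B ∈ filter (∁? proper?) F → B ≡ ⊤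
  full {B} B∈ = ∣p∣≡n⇒p≡⊤ (≤-antisym (∣p∣≤n B) (≮⇒≥ (proj₂ (∈-filter⁻ (∁? proper?) {xs = F} B∈))))
  atMostOne : bigCount (filter (∁? proper?) F) ≤ 1
  atMostOne = ≤-trans (length-filter big? (filter (∁? proper?) F))
    (length≤1-if-allEqual _ (Unique.filter⁺ (∁? proper?) {F} u) (All.tabulate full))

toℚᵘ-frac : ∀ a c → toℚᵘ (frac a (suc c)) ℚᵘ.≃ ℚᵘ.mkℚᵘ (ℤ.+ a) c
toℚᵘ-frac a c = ℚ.toℚᵘ-fromℚᵘ (ℚᵘ.mkℚᵘ (ℤ.+ a) c)

-- Nonnegative rationals are p/(q+1), so both inequalities below are cross-multiplications in ℕ.
frac≤mkℚ⇒cross : ∀ a {c} p q .(cop : Coprime p (suc q)) → 1 ≤ c →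
  frac a c ℚ.≤ mkℚ (ℤ.+ p) q cop → suc q * a ≤ p * c
frac≤mkℚ⇒cross a {suc c} p q cop _ a/c≤M with ℚᵘ.≤-respˡ-≃ (toℚᵘ-frac a c) (ℚ.toℚᵘ-mono-≤ a/c≤M)
... | ℚᵘ.*≤* a*q≤p*c = begin
  suc q * a  ≡⟨ *-comm (suc q) a ⟩
  a * suc q  ≤⟨ ℤ.drop‿+≤+ (subst₂ ℤ._≤_ (sym (ℤ.pos-* a (suc q))) (sym (ℤ.pos-* p (suc c))) a*q≤p*c) ⟩
  p * suc c  ∎
  where open ≤-Reasoning

cross⇒frac≤frac1+mkℚ : ∀ a c p q .(cop : Coprime p (suc q)) →
  suc q * a ≤ suc q + p * suc c → frac a (suc c) ℚ.≤ frac 1 (suc c) ℚ.+ mkℚ (ℤ.+ p) q cop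
cross⇒frac≤frac1+mkℚ a c p q cop cross = ℚ.toℚᵘ-cancel-≤
  (ℚᵘ.≤-respˡ-≃ (ℚᵘ.≃-sym (toℚᵘ-frac a c))
  (ℚᵘ.≤-respʳ-≃ (ℚᵘ.≃-sym (ℚᵘ.≃-trans (ℚ.toℚᵘ-homo-+ (frac 1 (suc c)) (mkℚ (ℤ.+ p) q cop))
                                        (ℚᵘ.+-congˡ (ℚᵘ.mkℚᵘ (ℤ.+ p) q) (toℚᵘ-frac 1 c))))
  (ℚᵘ.*≤* (subst₂ ℤ._≤_ lhs rhs (ℤ.+≤+ (*-monoˡ-≤ (suc c) cross))))))
  where
  lhs : ℤ.+ (suc q * a * suc c) ≡ ℤ.+ a ℤ.* ℤ.+ (suc c * suc q)
  lhs = trans (cong ℤ.+_ (trans (cong (_* suc c) (*-comm (suc q) a)) (trans (*-assoc a (suc q) (suc c))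
                (cong (a *_) (*-comm (suc q) (suc c))))))
              (ℤ.pos-* a (suc c * suc q))
  rhs : ℤ.+ ((suc q + p * suc c) * suc c) ≡ (ℤ.+ 1 ℤ.* ℤ.+ suc q ℤ.+ ℤ.+ p ℤ.* ℤ.+ suc c) ℤ.* ℤ.+ suc c
  rhs = trans (ℤ.pos-* (suc q + p * suc c) (suc c))
    (cong (ℤ._* ℤ.+ suc c) (trans (ℤ.pos-+ (suc q) (p * suc c))
      (cong₂ ℤ._+_ (sym (ℤ.*-identityˡ (ℤ.+ suc q))) (ℤ.pos-* p (suc c)))))

frac≤frac1+-byParts : (a c : X → ℕ) (xs : List X) (M : ℚ) → 0ℚ ℚ.≤ M →
  All (λ x → 1 ≤ c x × frac (a x) (c x) ℚ.≤ M) xs →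
  ∀ a₀ c₀ → 1 ≤ c₀ → a₀ ≤ 1 + sum (map a xs) → sum (map c xs) ≤ c₀ → frac a₀ c₀ ℚ.≤ frac 1 c₀ ℚ.+ M
frac≤frac1+-byParts a c xs (mkℚ -[1+ _ ] _ _) 0≤M with () ← nonNegative 0≤M
frac≤frac1+-byParts a c xs (mkℚ (ℤ.+ p) q cop) _ parts a₀ (suc c₀) _ a₀≤ Σc≤ =
  cross⇒frac≤frac1+mkℚ a₀ c₀ p q cop (begin
  suc q * a₀                                ≤⟨ *-monoʳ-≤ (suc q) a₀≤ ⟩
  suc q * (1 + sum (map a xs))              ≡⟨ *-distribˡ-+ (suc q) 1 _ ⟩
  suc q * 1 + suc q * sum (map a xs)        ≡⟨ cong₂ _+_ (*-identityʳ (suc q)) (sym (sum-map-*ˡ (suc q) a xs)) ⟩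
  suc q + sum (map (λ x → suc q * a x) xs)  ≤⟨ +-monoʳ-≤ (suc q) (sum-map-mono xs (All.map cross parts)) ⟩
  suc q + sum (map (λ x → p * c x) xs)      ≡⟨ cong (suc q +_) (sum-map-*ˡ p c xs) ⟩
  suc q + p * sum (map c xs)                ≤⟨ +-monoʳ-≤ (suc q) (*-monoʳ-≤ p Σc≤) ⟩
  suc q + p * suc c₀                        ∎)
  where
  open ≤-Reasoning
  cross : ∀ {x} → 1 ≤ c x × frac (a x) (c x) ℚ.≤ mkℚ (ℤ.+ p) q cop → suc q * a x ≤ p * c x
  cross (1≤c , a/c≤M) = frac≤mkℚ⇒cross _ p q cop 1≤c a/c≤M

1≤C2 : ∀ {k} → 2 ≤ k → 1 ≤ k C 2
1≤C2 {suc (suc k)} (s≤s (s≤s _)) =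
  ≤-trans (s≤s z≤n) (≤-trans (m≤n+m (suc k) _) (≤-reflexive (sym (C2-suc (suc k)))))

0≤frac : ∀ a c → 0ℚ ℚ.≤ frac a c
0≤frac a zero    = ℚ.≤-refl
0≤frac a (suc c) = ℚ.nonNegative⁻¹ _ {{ℚ.normalize-nonNeg a (suc c)}}

0≤maxRatio : ∀ f n → 0ℚ ℚ.≤ maxRatio f n
0≤maxRatio f 0 = ℚ.≤-refl
0≤maxRatio f 1 = ℚ.≤-refl
0≤maxRatio f 2 = ℚ.≤-refl
0≤maxRatio f 3 = 0≤frac (f 2) (2 C 2)
0≤maxRatio f (suc n@(suc (suc (suc _)))) = ℚ.≤-trans (0≤maxRatio f n) (ℚ.p≤p⊔q (maxRatio f n) (ratio f n))

ratio≤maxRatio : ∀ f {k} n → 2 ≤ k → k < n → ratio f k ℚ.≤ maxRatio f n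
ratio≤maxRatio f {1}                 _ (s≤s ()) _
ratio≤maxRatio f {suc (suc _)}       0 _ ()
ratio≤maxRatio f {suc (suc _)}       1 _ (s≤s ())
ratio≤maxRatio f {suc (suc _)}       2 _ (s≤s (s≤s ()))
ratio≤maxRatio f {2}                 3 _ _ = ℚ.≤-refl
ratio≤maxRatio f {suc (suc (suc _))} 3 _ (s≤s (s≤s (s≤s ())))
ratio≤maxRatio f (suc n@(suc (suc (suc _)))) 2≤k k<1+n =
  [ (λ k<n → ℚ.≤-trans (ratio≤maxRatio f n 2≤k k<n) (ℚ.p≤p⊔q (maxRatio f n) (ratio f n)))
  , (λ { refl → ℚ.p≤q⊔p (maxRatio f n) (ratio f n) })
  ]′ (m<1+n⇒m<n∨m≡n k<1+n)

proposition3p3 : (f : ℕ → ℕ) → (∀ k → IsF k (f k)) →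
    ∀ (n : ℕ) → 2 < n →
      ratio f n ℚ.≤ frac 1 (n C 2) ℚ.+ maxRatio f n
proposition3p3 f isF n 2<n with isF n
... | (F , unique , laminar , bigCount≡fn) , _ =
  frac≤frac1+-byParts (f ∘ ∣_∣) ((_C 2) ∘ ∣_∣) blocks (maxRatio f n) (0≤maxRatio f n)
    (All.zipWith blockRatio (blocks⊆F , blocks-big)) (f n) (n C 2) (1≤C2 (<⇒≤ 2<n))
    fn≤1+Σ (sum-C2-almostDisjoint n blocks almostDisjoint)
  where
  open Blocks (blocksOf (λ {k} → proj₂ (isF k)) (filter proper? F) (<-wellFounded _)
                        (Unique.filter⁺ proper? {F} unique) (TwoLaminar-filter proper? laminar))
  fn≤1+Σ : f n ≤ 1 + sum (map (f ∘ ∣_∣) blocks)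
  fn≤1+Σ = subst (_≤ 1 + sum (map (f ∘ ∣_∣) blocks)) bigCount≡fn
    (≤-trans (bigCount≤1+bigCount-proper F unique) (+-monoʳ-≤ 1 bigCount≤))
  blockRatio : ∀ {A} → A ∈ filter proper? F × 2 ≤ ∣ A ∣ → 1 ≤ ∣ A ∣ C 2 × ratio f ∣ A ∣ ℚ.≤ maxRatio f n
  blockRatio (A∈ , big) = 1≤C2 big , ratio≤maxRatio f n big (proj₂ (∈-filter⁻ proper? {xs = F} A∈))
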